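{- Let $K$ be a field of characteristic different from $2$, $n\ge 1$, and $R=K[a_{i,j}\mid 1\le i<j\le 2n]$ with the convention $a_{j,i}:=a_{i,j}$ for $i<j$ (symmetric generators), and let $S_{2n}$ act on $R$ by $K$-algebra automorphisms determined by $\mu\, a_{i,j}=a_{\mu^{ -1}(i),\mu^{ -1}(j)}$. Let $pf_{2n}=\sum_{\pi\in S_{2n,pf}}\operatorname{sign}(\pi)\,a_{i_1,j_1}\cdots a_{i_n,j_n}$. Then $\mu(pf_{2n})=pf_{2n}$ for every $\mu\in D_{2n}$.
   Context: $S_{2n,pf}$ is the set of permutations $\pi\in S_{2n}$ with one-line notation $\pi=(i_1,j_1,\ldots,i_n,j_n)$ satisfying $i_1<i_2<\cdots<i_n$ and $i_s<j_s$ for all $s$; $\operatorname{sign}(\pi)$ is the sign of the permutation. $D_{2n}$ is the subgroup of $S_{2n}$ (of permutations induced by symmetries of a regular $2n$-gon with vertices labelled $1,\ldots,2n$ in cyclic order) generated by the cyclic shift $i\mapsto i+1\pmod{2n}$ and the reflection fixing $1$ and sending $i\mapsto 2n+2-i$ for $2\le i\le 2n$. -}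

module Defs where

open import Level using (Level)
open import Algebra.Bundles using (CommutativeRing)
open import Data.Bool using (Bool; true; false; _∧_; _∨_; if_then_else_)
open import Data.Nat using (ℕ; zero; suc; _<ᵇ_; _≡ᵇ_)
import Data.Nat as ℕ
open import Data.Nat.DivMod using (_mod_)
open import Data.Fin using (Fin; toℕ)
open import Data.Fin.Permutation using (Permutation; _⟨$⟩ʳ_; _⟨$⟩ˡ_; id; flip; _∘ₚ_)
open import Data.List using (List; []; _∷_; map; concatMap; foldr; allFin; filter)
open import Data.Product using (_×_; _,_; Σ; ∃)
open import Relation.Nullary using (¬_)
open import Relation.Binary.PropositionalEquality using (_≡_)

IsField : ∀ {c ℓ} → CommutativeRing c ℓ → Set (c Level.⊔ ℓ)
IsField K = ¬ (1# ≈ 0#) × (∀ x → ¬ (x ≈ 0#) → ∃ λ y → x * y ≈ 1#)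
  where open CommutativeRing K

CharNot2 : ∀ {c ℓ} → CommutativeRing c ℓ → Set ℓ
CharNot2 K = ¬ ((1# + 1#) ≈ 0#)
  where open CommutativeRing K

-- Polynomials in R = K[a_{i,j} | i<j] over vertex set Fin m
-- (labels 1..m of the paper correspond to 0..m-1).
-- A monomial is written as a list of index pairs (p , q), the pair
-- standing for the generator a_{p,q} (= a_{q,p}, symmetric convention).

Mon : ℕ → Set
Mon m = List (Fin m × Fin m)

Poly : ∀ {c ℓ} → CommutativeRing c ℓ → ℕ → Set c
Poly K m = List (CommutativeRing.Carrier K × Mon m)

_==_ : ∀ {m} → Fin m → Fin m → Bool
i == j = toℕ i ≡ᵇ toℕ j

expo : ∀ {m} → Mon m → Fin m → Fin m → ℕ
expo [] i j = zero
expo ((p , q) ∷ ms) i j =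
  if (p == i ∧ q == j) ∨ (p == j ∧ q == i) then suc (expo ms i j) else expo ms i j

genIdx : (m : ℕ) → List (Fin m × Fin m)
genIdx m = filter? (concatMap (λ i → map (λ j → (i , j)) (allFin m)) (allFin m))
  where
  filter? : List (Fin m × Fin m) → List (Fin m × Fin m)
  filter? [] = []
  filter? ((i , j) ∷ xs) = if toℕ i <ᵇ toℕ j then (i , j) ∷ filter? xs else filter? xs

hasExp : ∀ {m} → Mon m → (Fin m → Fin m → ℕ) → Bool
hasExp {m} ms e = foldr (λ { (i , j) b → (expo ms i j ≡ᵇ e i j) ∧ b }) true (genIdx m)

coeff : ∀ {c ℓ} (K : CommutativeRing c ℓ) {m} → Poly K m →
        (Fin m → Fin m → ℕ) → CommutativeRing.Carrier K
coeff K P e = foldr (λ { (c , ms) acc → if hasExp ms e then c + acc else acc }) 0# P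
  where open CommutativeRing K

PolyEq : ∀ {c ℓ} (K : CommutativeRing c ℓ) {m} → Poly K m → Poly K m → Set ℓ
PolyEq K P Q = ∀ e → coeff K P e ≈ coeff K Q e
  where open CommutativeRing K

-- action of μ ∈ S_m by K-algebra automorphisms: μ a_{i,j} = a_{μ⁻¹ i, μ⁻¹ j}
act : ∀ {c ℓ} {K : CommutativeRing c ℓ} {m} → Permutation m m → Poly K m → Poly K m
act μ P = map (λ { (c , ms) → (c , map (λ { (p , q) → (μ ⟨$⟩ˡ p , μ ⟨$⟩ˡ q) }) ms) }) P

insertions : ∀ {A : Set} → A → List A → List (List A)
insertions x [] = (x ∷ []) ∷ []
insertions x (y ∷ ys) = (x ∷ y ∷ ys) ∷ map (y ∷_) (insertions x ys)

-- all orderings of a list (one-line notations of all permutations)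
perms : ∀ {A : Set} → List A → List (List A)
perms [] = [] ∷ []
perms (x ∷ xs) = concatMap (insertions x) (perms xs)

_>?_ : ∀ {m} → Fin m → Fin m → Bool
i >? j = toℕ j <ᵇ toℕ i

inversions : ∀ {m} → List (Fin m) → ℕ
inversions [] = zero
inversions (x ∷ xs) = foldr (λ y n → if x >? y then suc n else n) zero xs ℕ.+ inversions xs

even : ℕ → Bool
even zero = true
even (suc n) = not′ (even n)
  where
  not′ : Bool → Bool
  not′ true = false
  not′ false = true

sign : ∀ {c ℓ} (K : CommutativeRing c ℓ) {m} → List (Fin m) → CommutativeRing.Carrier K
sign K π = if even (inversions π) then 1# else - 1#
  where open CommutativeRing K

pairsOf : ∀ {A : Set} → List A → List (A × A)
pairsOf (x ∷ y ∷ zs) = (x , y) ∷ pairsOf zs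
pairsOf _ = []

isPfPairs : ∀ {m} → List (Fin m × Fin m) → Bool
isPfPairs [] = true
isPfPairs ((i , j) ∷ []) = toℕ i <ᵇ toℕ j
isPfPairs ((i , j) ∷ (i' , j') ∷ ps) =
  (toℕ i <ᵇ toℕ j) ∧ (toℕ i <ᵇ toℕ i') ∧ isPfPairs ((i' , j') ∷ ps)

Spf : (n : ℕ) → List (List (Fin (2 ℕ.* n)))
Spf n = filter′ (perms (allFin (2 ℕ.* n)))
  where
  filter′ : List (List (Fin (2 ℕ.* n))) → List (List (Fin (2 ℕ.* n)))
  filter′ [] = []
  filter′ (π ∷ πs) = if isPfPairs (pairsOf π) then π ∷ filter′ πs else filter′ πs

pf : ∀ {c ℓ} (K : CommutativeRing c ℓ) (n : ℕ) → Poly K (2 ℕ.* n)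
pf K n = map (λ π → (sign K π , pairsOf π)) (Spf n)

shiftF : (m : ℕ) → Fin m → Fin m
shiftF (suc m) i = suc (toℕ i) mod suc m

-- reflection fixing label 1: label i ↦ m + 2 - i (i ≥ 2), i.e. k ↦ (m - k) mod m
reflF : (m : ℕ) → Fin m → Fin m
reflF (suc m) i = (suc m ℕ.∸ toℕ i) mod suc m

data InD (m : ℕ) : Permutation m m → Set where
  gen-shift : ∀ ρ → (∀ i → ρ ⟨$⟩ʳ i ≡ shiftF m i) → InD m ρ
  gen-refl  : ∀ ρ → (∀ i → ρ ⟨$⟩ʳ i ≡ reflF m i) → InD m ρ
  d-id      : InD m id
  d-comp    : ∀ {ρ σ} → InD m ρ → InD m σ → InD m (ρ ∘ₚ σ)
  d-inv     : ∀ {ρ} → InD m ρ → InD m (flip ρ)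

module Submission where

open import Defs
open import Algebra.Bundles using (CommutativeRing)
open import Data.Nat using (ℕ; _≤_; _*_)
open import Data.Fin.Permutation using (Permutation)

import Algebra.Properties.CommutativeSemigroup as CommutativeSemigroupₚ
open import Data.Bool using (Bool; true; false; not; _∧_; _∨_; _xor_; if_then_else_)
import Data.Bool.Properties as Boolₚ
open import Data.Empty using (⊥-elim)
open import Data.Fin using (Fin; toℕ)
open import Data.Fin.Permutation using (_⟨$⟩ʳ_; _⟨$⟩ˡ_; inverseˡ; inverseʳ; flip)
import Data.Fin.Properties as Finₚ
open import Data.List using (List; []; _∷_; map; concatMap; allFin; _++_; length; foldr)
import Data.List.Properties as Listₚ
open import Data.List.Membership.Propositional using (_∈_; _∉_; lose; find)
import Data.List.Membership.Propositional.Properties as ∈ₚ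
open import Data.List.Membership.Propositional.Properties.WithK using (unique∧set⇒bag)
open import Data.List.Relation.Binary.BagAndSetEquality using (∼bag⇒↭)
open import Data.List.Relation.Binary.Permutation.Propositional
  using (_↭_; ↭-refl; ↭-sym; ↭-trans; ↭⇒↭ₛ)
import Data.List.Relation.Binary.Permutation.Propositional as ↭
import Data.List.Relation.Binary.Permutation.Propositional.Properties as ↭ₚ
import Data.List.Relation.Binary.Permutation.Setoid.Properties as ↭ₛₚ
open import Data.List.Relation.Unary.All as All using (All; []; _∷_)
import Data.List.Relation.Unary.All.Properties as Allₚ
open import Data.List.Relation.Unary.AllPairs as AllPairs using (AllPairs; []; _∷_)
open import Data.List.Relation.Unary.Any using (Any; here; there; any?)
open import Data.List.Relation.Unary.Unique.Propositional using (Unique)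
import Data.List.Relation.Unary.Unique.Propositional.Properties as Uniqueₚ
open import Data.Nat using (zero; suc; _<_; _+_; _∸_; _<ᵇ_; _≡ᵇ_)
import Data.Nat.DivMod as DivMod
import Data.Nat.Properties as ℕₚ
open import Data.Product using (_×_; _,_; proj₁; proj₂)
import Data.Product as Product
open import Data.Sum using (_⊎_; inj₁; inj₂)
open import Function using (_∘_; id)
open import Function.Bundles using (mk⇔)
open import Relation.Binary.Definitions using (DecidableEquality; tri<; tri≈; tri>)
open import Relation.Binary.PropositionalEquality
  using (_≡_; _≢_; refl; sym; trans; cong; cong₂; subst; module ≡-Reasoning)
import Relation.Binary.PropositionalEquality as ≡
open import Relation.Nullary using (¬_; contradiction; yes; no)
open import Relation.Nullary.Reflects using (Reflects; ofʸ; ofⁿ; fromEquivalence)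

open ≡-Reasoning

-- Expanded over S_{2n,pf}, pf_{2n} has one term for each perfect matching of
-- the vertices, with the monomial of its chords. Placing the vertices in
-- order on a circle, the sign of a term is (-1) to the number of pairs of
-- crossing chords: in the one-line notation of a matching in standard form,
-- a chord (c , d) after the chord (a , b) forms [c < b] + [d < b] inversions
-- with b, which is odd exactly when the two chords cross. A symmetry of
-- the 2n-gon maps perfect matchings bijectively to perfect matchings and
-- preserves crossings, so it permutes the terms of pf_{2n} with their signs.

<ᵇ-true : ∀ {a b} → a < b → (a <ᵇ b) ≡ true
<ᵇ-true {a} {b} a<b with a <ᵇ b | ℕₚ.<ᵇ-reflects-< a b
... | true  | _       = refl
... | false | ofⁿ a≮b = contradiction a<b a≮b

<ᵇ-false : ∀ {a b} → b ≤ a → (a <ᵇ b) ≡ false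
<ᵇ-false {a} {b} b≤a with a <ᵇ b | ℕₚ.<ᵇ-reflects-< a b
... | false | _       = refl
... | true  | ofʸ a<b = contradiction b≤a (ℕₚ.<⇒≱ a<b)

<ᵇ-true⇒< : ∀ {a b} → (a <ᵇ b) ≡ true → a < b
<ᵇ-true⇒< {a} {b} eq with a <ᵇ b | ℕₚ.<ᵇ-reflects-< a b
<ᵇ-true⇒< refl | true | ofʸ a<b = a<b

≡ᵇ-reflects-≡ : ∀ a b → Reflects (a ≡ b) (a ≡ᵇ b)
≡ᵇ-reflects-≡ a b = fromEquivalence (ℕₚ.≡ᵇ⇒≡ a b) (ℕₚ.≡⇒≡ᵇ a b)

≡ᵇ-true⇒≡ : ∀ {a b} → (a ≡ᵇ b) ≡ true → a ≡ b
≡ᵇ-true⇒≡ {a} {b} eq with a ≡ᵇ b | ≡ᵇ-reflects-≡ a b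
≡ᵇ-true⇒≡ refl | true | ofʸ a≡b = a≡b

≡ᵇ-refl : ∀ a → (a ≡ᵇ a) ≡ true
≡ᵇ-refl zero    = refl
≡ᵇ-refl (suc a) = ≡ᵇ-refl a

≡ᵇ-false : ∀ {a b} → a ≢ b → (a ≡ᵇ b) ≡ false
≡ᵇ-false {a} {b} a≢b with a ≡ᵇ b | ≡ᵇ-reflects-≡ a b
... | false | _       = refl
... | true  | ofʸ a≡b = contradiction a≡b a≢b

module _ {m : ℕ} where

  ==-reflects-≡ : (i j : Fin m) → Reflects (i ≡ j) (i == j)
  ==-reflects-≡ i j = fromEquivalence (Finₚ.toℕ-injective ∘ ℕₚ.≡ᵇ⇒≡ _ _) (ℕₚ.≡⇒≡ᵇ _ _ ∘ cong toℕ)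

  ==-refl : (i : Fin m) → (i == i) ≡ true
  ==-refl i = ≡ᵇ-refl (toℕ i)

  ==-true⇒≡ : ∀ (i j : Fin m) → (i == j) ≡ true → i ≡ j
  ==-true⇒≡ i j = Finₚ.toℕ-injective ∘ ≡ᵇ-true⇒≡

-- Spf and genIdx are defined through anonymous where-bound filters; each mutual
-- block below solves the meta on the left by unification with the
-- right-hand side, which names that filter so that it can be reasoned
-- about by induction.

mutual
  spfFilter : (n : ℕ) → List (List (Fin (2 * n))) → List (List (Fin (2 * n)))
  spfFilter = _

  Spf≡spfFilter : ∀ n → Spf n ≡ spfFilter n (perms (allFin (2 * n)))
  Spf≡spfFilter n with perms (allFin (2 * n))
  ... | πs = refl

mutual
  genFilter : (m : ℕ) → List (Fin m × Fin m) → List (Fin m × Fin m)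
  genFilter = _

  genIdx≡genFilter : ∀ m →
    genIdx m ≡ genFilter m (concatMap (λ i → map (i ,_) (allFin m)) (allFin m))
  genIdx≡genFilter m with concatMap (λ i → map (i ,_) (allFin m)) (allFin m)
  ... | ps = refl

both : ∀ {A B : Set} → (A → B) → A × A → B × B
both f (p , q) = (f p , f q)

module _ {m : ℕ} where

  joins : Fin m → Fin m → Fin m × Fin m → Bool
  joins i j (p , q) = (p == i ∧ q == j) ∨ (p == j ∧ q == i)

  expo-map : (F : Fin m × Fin m → Fin m × Fin m) {i j i′ j′ : Fin m} →
             (∀ c → joins i j (F c) ≡ joins i′ j′ c) →
             ∀ ms → expo (map F ms) i j ≡ expo ms i′ j′
  expo-map F h []       = refl
  expo-map F h (c ∷ ms) rewrite h c | expo-map F h ms = refl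

  joins-swap : ∀ i j c → joins i j (Product.swap c) ≡ joins i j c
  joins-swap i j (p , q) =
    trans (cong₂ _∨_ (Boolₚ.∧-comm (q == i) (p == j)) (Boolₚ.∧-comm (q == j) (p == i)))
          (Boolₚ.∨-comm (p == j ∧ q == i) (p == i ∧ q == j))

  expo-↭ : ∀ {ms ms′ : Mon m} → ms ↭ ms′ → ∀ i j → expo ms i j ≡ expo ms′ i j
  expo-↭ ↭.refl         i j = refl
  expo-↭ (↭.prep c p)   i j rewrite expo-↭ p i j = refl
  expo-↭ (↭.swap c d p) i j rewrite expo-↭ p i j with joins i j c | joins i j d
  ... | true  | true  = refl
  ... | true  | false = refl
  ... | false | true  = refl
  ... | false | false = refl
  expo-↭ (↭.trans p q)  i j = trans (expo-↭ p i j) (expo-↭ q i j)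

  module _ (σ : Permutation m m) where

    ⟨$⟩ʳ-injective : ∀ {x y} → σ ⟨$⟩ʳ x ≡ σ ⟨$⟩ʳ y → x ≡ y
    ⟨$⟩ʳ-injective σx≡σy = trans (sym (inverseˡ σ)) (trans (cong (σ ⟨$⟩ˡ_) σx≡σy) (inverseˡ σ))

    ⟨$⟩ˡ-injective : ∀ {x y} → σ ⟨$⟩ˡ x ≡ σ ⟨$⟩ˡ y → x ≡ y
    ⟨$⟩ˡ-injective σx≡σy = trans (sym (inverseʳ σ)) (trans (cong (σ ⟨$⟩ʳ_) σx≡σy) (inverseʳ σ))

    ==-transpose : ∀ a b → ((σ ⟨$⟩ˡ a) == b) ≡ (a == (σ ⟨$⟩ʳ b))
    ==-transpose a b with (σ ⟨$⟩ˡ a) == b | ==-reflects-≡ (σ ⟨$⟩ˡ a) b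
                        | a == (σ ⟨$⟩ʳ b) | ==-reflects-≡ a (σ ⟨$⟩ʳ b)
    ... | true  | _        | true  | _        = refl
    ... | false | _        | false | _        = refl
    ... | true  | ofʸ σa≡b | false | ofⁿ a≢σb =
      contradiction (trans (sym (inverseʳ σ)) (cong (σ ⟨$⟩ʳ_) σa≡b)) a≢σb
    ... | false | ofⁿ σa≢b | true  | ofʸ a≡σb =
      contradiction (trans (cong (σ ⟨$⟩ˡ_) a≡σb) (inverseˡ σ)) σa≢b

    expo-relabel : ∀ (ms : Mon m) i j →
                   expo (map (both (σ ⟨$⟩ˡ_)) ms) i j ≡ expo ms (σ ⟨$⟩ʳ i) (σ ⟨$⟩ʳ j)
    expo-relabel ms i j = expo-map (both (σ ⟨$⟩ˡ_)) joins-relabel ms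
      where
      joins-relabel : ∀ c → joins i j (both (σ ⟨$⟩ˡ_) c) ≡ joins (σ ⟨$⟩ʳ i) (σ ⟨$⟩ʳ j) c
      joins-relabel (p , q)
        rewrite ==-transpose p i | ==-transpose q j | ==-transpose p j | ==-transpose q i = refl

∧-true : ∀ {a b} → a ∧ b ≡ true → a ≡ true × b ≡ true
∧-true {true} b≡true = refl , b≡true

foldr-∧-true⇒All : ∀ {A : Set} (p : A → Bool) xs →
            foldr (λ x b → p x ∧ b) true xs ≡ true → All (λ x → p x ≡ true) xs
foldr-∧-true⇒All p []       _   = []
foldr-∧-true⇒All p (x ∷ xs) all =
  let (px , rest) = ∧-true all in px ∷ foldr-∧-true⇒All p xs rest

module _ {m : ℕ} where

  ∈-genFilter : ∀ {i j : Fin m} → toℕ i < toℕ j →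
                ∀ {ps} → (i , j) ∈ ps → (i , j) ∈ genFilter m ps
  ∈-genFilter i<j {(i , j) ∷ ps} (here refl) rewrite <ᵇ-true i<j = here refl
  ∈-genFilter i<j {(i′ , j′) ∷ ps} (there ij∈ps) with toℕ i′ <ᵇ toℕ j′
  ... | true  = there (∈-genFilter i<j ij∈ps)
  ... | false = ∈-genFilter i<j ij∈ps

  ∈-genIdx : ∀ {i j : Fin m} → toℕ i < toℕ j → (i , j) ∈ genIdx m
  ∈-genIdx {i} {j} i<j rewrite genIdx≡genFilter m =
    ∈-genFilter i<j (∈ₚ.∈-concatMap⁺ (λ i → map (i ,_) (allFin m))
                      (lose (∈ₚ.∈-allFin i) (∈ₚ.∈-map⁺ (i ,_) (∈ₚ.∈-allFin j))))

  hasExp-cong : ∀ (ms ms′ : Mon m) → (∀ i j → expo ms i j ≡ expo ms′ i j) →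
                ∀ e → hasExp ms e ≡ hasExp ms′ e
  hasExp-cong ms ms′ h e =
    Listₚ.foldr-cong (λ (i , j) b → cong (λ k → (k ≡ᵇ e i j) ∧ b) (h i j)) refl (genIdx m)

  hasExp⇒expo : ∀ (ms : Mon m) e → hasExp ms e ≡ true →
                ∀ {i j} → toℕ i < toℕ j → expo ms i j ≡ e i j
  hasExp⇒expo ms e has i<j =
    ≡ᵇ-true⇒≡ (All.lookup (foldr-∧-true⇒All _ (genIdx m) has) (∈-genIdx i<j))

module Coefficients {c ℓ} (K : CommutativeRing c ℓ) {m : ℕ} (e : Fin m → Fin m → ℕ)
                    {X : Set} (t : X → CommutativeRing.Carrier K × Mon m) where
  open CommutativeRing K using (_≈_; 0#; +-congˡ; +-identityʳ)
    renaming (refl to ≈-refl; trans to ≈-trans)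

  HasExp : X → Set
  HasExp x = hasExp (proj₂ (t x)) e ≡ true

  coeff-map-none : ∀ xs → (∀ {x} → x ∈ xs → ¬ HasExp x) → coeff K (map t xs) e ≈ 0#
  coeff-map-none []       _    = ≈-refl
  coeff-map-none (x ∷ xs) miss with hasExp (proj₂ (t x)) e in hit
  ... | true  = contradiction hit (miss (here refl))
  ... | false = coeff-map-none xs (miss ∘ there)

  coeff-map-single : ∀ {xs x} → Unique xs → x ∈ xs → HasExp x →
                     (∀ {y} → y ∈ xs → HasExp y → y ≡ x) → coeff K (map t xs) e ≈ proj₁ (t x)
  coeff-map-single {x ∷ xs} (x∉xs ∷ _) (here refl) hit only rewrite hit =
    ≈-trans (+-congˡ (coeff-map-none xs λ y∈xs hy →
               All.lookup x∉xs y∈xs (sym (only (there y∈xs) hy))))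
            (+-identityʳ _)
  coeff-map-single {y ∷ xs} (y∉xs ∷ u) (there x∈xs) hit only with hasExp (proj₂ (t y)) e in hy
  ... | true  = contradiction (only (here refl) hy) (All.lookup y∉xs x∈xs)
  ... | false = coeff-map-single u x∈xs hit (only ∘ there)

module _ {A : Set} where

  insertions-↭ : ∀ (x : A) ys {zs} → zs ∈ insertions x ys → zs ↭ x ∷ ys
  insertions-↭ x []       (here refl) = ↭-refl
  insertions-↭ x (y ∷ ys) (here refl) = ↭-refl
  insertions-↭ x (y ∷ ys) (there zs∈) with ∈ₚ.∈-map⁻ (y ∷_) zs∈
  ... | _ , zs′∈ , refl = ↭-trans (↭.prep y (insertions-↭ x ys zs′∈)) (↭.swap y x ↭-refl)

  ∈-insertions : ∀ (x : A) ys₁ ys₂ → ys₁ ++ x ∷ ys₂ ∈ insertions x (ys₁ ++ ys₂)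
  ∈-insertions x []        []       = here refl
  ∈-insertions x []        (_ ∷ _)  = here refl
  ∈-insertions x (y ∷ ys₁) ys₂      = there (∈ₚ.∈-map⁺ (y ∷_) (∈-insertions x ys₁ ys₂))

  ∈-perms⇒↭ : ∀ (xs : List A) {zs} → zs ∈ perms xs → zs ↭ xs
  ∈-perms⇒↭ []       (here refl) = ↭-refl
  ∈-perms⇒↭ (x ∷ xs) zs∈ with find (∈ₚ.∈-concatMap⁻ (insertions x) {xs = perms xs} zs∈)
  ... | ys , ys∈ , zs∈ys = ↭-trans (insertions-↭ x ys zs∈ys) (↭.prep x (∈-perms⇒↭ xs ys∈))

  ↭⇒∈-perms : ∀ (xs : List A) {zs} → zs ↭ xs → zs ∈ perms xs
  ↭⇒∈-perms []       zs↭ rewrite ↭ₚ.↭-empty-inv zs↭ = here refl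
  ↭⇒∈-perms (x ∷ xs) zs↭ with ∈ₚ.∈-∃++ (↭ₚ.∈-resp-↭ (↭-sym zs↭) (here refl))
  ... | ys₁ , ys₂ , refl =
    ∈ₚ.∈-concatMap⁺ (insertions x) (lose (↭⇒∈-perms xs ys↭) (∈-insertions x ys₁ ys₂))
    where
    ys↭ : ys₁ ++ ys₂ ↭ xs
    ys↭ = ↭ₚ.drop-∷ (↭-trans (↭-sym (↭ₚ.shift x ys₁ ys₂)) zs↭)

module _ {A : Set} where

  unique-↭ : ∀ {xs ys : List A} → xs ↭ ys → Unique xs → Unique ys
  unique-↭ p = ↭ₛₚ.Unique-resp-↭ (≡.setoid A) (↭⇒↭ₛ p)

module _ {A B : Set} where

  concatMap-unique : (f : A → List B) (g : B → A) {xs : List A} →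
                     (∀ {x z} → x ∈ xs → z ∈ f x → g z ≡ x) →
                     (∀ {x} → x ∈ xs → Unique (f x)) → Unique xs → Unique (concatMap f xs)
  concatMap-unique f g {[]}     _       _    _           = []
  concatMap-unique f g {x ∷ xs} retract uniq (x∉xs ∷ u) =
    Uniqueₚ.++⁺ (uniq (here refl)) (concatMap-unique f g (retract ∘ there) (uniq ∘ there) u)
                disjoint
    where
    disjoint : ∀ {z} → ¬ (z ∈ f x × z ∈ concatMap f xs)
    disjoint (z∈fx , z∈rest) with find (∈ₚ.∈-concatMap⁻ f {xs = xs} z∈rest)
    ... | x′ , x′∈xs , z∈fx′ =
      All.lookup x∉xs x′∈xs (trans (sym (retract (here refl) z∈fx)) (retract (there x′∈xs) z∈fx′))

module _ {A : Set} (_≟_ : DecidableEquality A) where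

  remove : A → List A → List A
  remove x []       = []
  remove x (z ∷ zs) with z ≟ x
  ... | yes _ = zs
  ... | no  _ = z ∷ remove x zs

  remove-head : ∀ x zs → remove x (x ∷ zs) ≡ zs
  remove-head x zs with x ≟ x
  ... | yes _   = refl
  ... | no  x≢x = contradiction refl x≢x

  remove-insertions : ∀ x ys {zs} → x ∉ ys → zs ∈ insertions x ys → remove x zs ≡ ys
  remove-insertions x []       _   (here refl) = remove-head x []
  remove-insertions x (y ∷ ys) _   (here refl) = remove-head x (y ∷ ys)
  remove-insertions x (y ∷ ys) x∉ (there zs∈) with ∈ₚ.∈-map⁻ (y ∷_) zs∈
  ... | _ , zs′∈ , refl with y ≟ x
  ... | yes y≡x = contradiction (here (sym y≡x)) x∉
  ... | no  _   = cong (y ∷_) (remove-insertions x ys (x∉ ∘ there) zs′∈)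

  insertions-unique : ∀ (x : A) ys → x ∉ ys → Unique (insertions x ys)
  insertions-unique x []       _  = [] ∷ []
  insertions-unique x (y ∷ ys) x∉ =
    All.tabulate head-differs
    ∷ Uniqueₚ.map⁺ Listₚ.∷-injectiveʳ (insertions-unique x ys (x∉ ∘ there))
    where
    head-differs : ∀ {zs} → zs ∈ map (y ∷_) (insertions x ys) → x ∷ y ∷ ys ≢ zs
    head-differs zs∈ x∷y∷ys≡zs with ∈ₚ.∈-map⁻ (y ∷_) zs∈
    ... | _ , _ , refl = x∉ (here (Listₚ.∷-injectiveˡ x∷y∷ys≡zs))

  perms-unique : ∀ (xs : List A) → Unique xs → Unique (perms xs)
  perms-unique []       _            = [] ∷ []
  perms-unique (x ∷ xs) (x∉xs ∷ u) =
    concatMap-unique (insertions x) (remove x)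
      (λ ys∈ zs∈ → remove-insertions x _ (x∉ ys∈) zs∈)
      (λ ys∈ → insertions-unique x _ (x∉ ys∈))
      (perms-unique xs u)
    where
    x∉ : ∀ {ys} → ys ∈ perms xs → x ∉ ys
    x∉ ys∈ x∈ys = All.lookup x∉xs (↭ₚ.∈-resp-↭ (∈-perms⇒↭ xs ys∈) x∈ys) refl

module _ {A : Set} where

  flat : List (A × A) → List A
  flat []             = []
  flat ((a , b) ∷ P) = a ∷ b ∷ flat P

  pairsOf-flat : ∀ (P : List (A × A)) → pairsOf (flat P) ≡ P
  pairsOf-flat []             = refl
  pairsOf-flat ((a , b) ∷ P) = cong ((a , b) ∷_) (pairsOf-flat P)

  flat-pairsOf : ∀ k (xs : List A) → length xs ≡ k + k → flat (pairsOf xs) ≡ xs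
  flat-pairsOf zero    []           _   = refl
  flat-pairsOf (suc k) (a ∷ [])     len with () ← trans (ℕₚ.suc-injective len) (ℕₚ.+-suc k k)
  flat-pairsOf (suc k) (a ∷ b ∷ xs) len =
    cong (λ t → a ∷ b ∷ t)
         (flat-pairsOf k xs (ℕₚ.suc-injective (trans (ℕₚ.suc-injective len) (ℕₚ.+-suc k k))))

  flat-↭ : ∀ {P P′ : List (A × A)} → P ↭ P′ → flat P ↭ flat P′
  flat-↭ ↭.refl                        = ↭-refl
  flat-↭ (↭.prep (a , b) p)            = ↭.prep a (↭.prep b (flat-↭ p))
  flat-↭ (↭.swap (a , b) (c , d) p)    =
    ↭-trans (↭ₚ.shifts (a ∷ b ∷ []) (c ∷ d ∷ []))
            (↭.prep c (↭.prep d (↭.prep a (↭.prep b (flat-↭ p)))))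
  flat-↭ (↭.trans p q)                 = ↭-trans (flat-↭ p) (flat-↭ q)

module _ {m : ℕ} where

  record IsStandard (P : Mon m) : Set where
    constructor standard
    field isPfPairs-true : isPfPairs P ≡ true

  standard-∷∷⁻ : ∀ {a b c d : Fin m} {R} → IsStandard ((a , b) ∷ (c , d) ∷ R) →
                 toℕ a < toℕ b × toℕ a < toℕ c × IsStandard ((c , d) ∷ R)
  standard-∷∷⁻ {a} {b} {c} (standard s) with toℕ a <ᵇ toℕ b in a<b | toℕ a <ᵇ toℕ c in a<c
  ... | true  | true  = <ᵇ-true⇒< a<b , <ᵇ-true⇒< a<c , standard s
  standard-∷∷⁻ (standard ()) | true  | false
  standard-∷∷⁻ (standard ()) | false | _

  standard-∷∷⁺ : ∀ {a b c d : Fin m} {R} → toℕ a < toℕ b → toℕ a < toℕ c →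
                 IsStandard ((c , d) ∷ R) → IsStandard ((a , b) ∷ (c , d) ∷ R)
  standard-∷∷⁺ {c = c} {d} {R} a<b a<c (standard s) =
    standard (trans (cong₂ (λ x y → x ∧ y ∧ isPfPairs ((c , d) ∷ R)) (<ᵇ-true a<b) (<ᵇ-true a<c)) s)

  standard-head : ∀ {a b R} → IsStandard ((a , b) ∷ R) → toℕ a < toℕ b
  standard-head {R = []}    (standard s) = <ᵇ-true⇒< s
  standard-head {R = _ ∷ _} s            = proj₁ (standard-∷∷⁻ s)

  standard-tail : ∀ {a b R} → IsStandard ((a , b) ∷ R) → IsStandard R
  standard-tail {R = []}    _ = standard refl
  standard-tail {R = _ ∷ _} s = proj₂ (proj₂ (standard-∷∷⁻ s))

  standard-above : ∀ {a b R} → IsStandard ((a , b) ∷ R) → All (λ x → toℕ a < toℕ x) (flat R)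
  standard-above {R = []}          _ = []
  standard-above {R = (c , d) ∷ R} s =
    a<c ∷ ℕₚ.<-trans a<c (standard-head s′) ∷ All.map (ℕₚ.<-trans a<c) (standard-above s′)
    where
    s′  = standard-tail s
    a<c = proj₁ (proj₂ (standard-∷∷⁻ s))

  standard-lower : ∀ {a b R i} → IsStandard ((a , b) ∷ R) → i ∈ flat ((a , b) ∷ R) → toℕ a ≤ toℕ i
  standard-lower s (here refl)         = ℕₚ.≤-refl
  standard-lower s (there (here refl)) = ℕₚ.<⇒≤ (standard-head s)
  standard-lower s (there (there i∈))  = ℕₚ.<⇒≤ (All.lookup (standard-above s) i∈)

  joins-true : ∀ {i j : Fin m} c → joins i j c ≡ true →
               (proj₁ c ≡ i × proj₂ c ≡ j) ⊎ (proj₁ c ≡ j × proj₂ c ≡ i)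
  joins-true {i} {j} (p , q) eq with p == i in p=i | q == j in q=j
  ... | true  | true  = inj₁ (==-true⇒≡ p i p=i , ==-true⇒≡ q j q=j)
  ... | true  | false = inj₂ (Product.map (==-true⇒≡ p j) (==-true⇒≡ q i) (∧-true eq))
  ... | false | _     = inj₂ (Product.map (==-true⇒≡ p j) (==-true⇒≡ q i) (∧-true eq))

  Joins : Fin m → Fin m → Mon m → Set
  Joins i j = Any (λ c → joins i j c ≡ true)

  Joins⇒∈ : ∀ {i j} P → Joins i j P → i ∈ flat P
  Joins⇒∈ ((p , q) ∷ P) (here c) with joins-true (p , q) c
  ... | inj₁ (refl , _) = here refl
  ... | inj₂ (_ , refl) = there (here refl)
  Joins⇒∈ ((p , q) ∷ P) (there J) = there (there (Joins⇒∈ P J))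

  expo-suc⇒Joins : ∀ P {i j k} → expo P i j ≡ suc k → Joins i j P
  expo-suc⇒Joins (c ∷ P) {i} {j} e with joins i j c in c-joins
  ... | true  = here c-joins
  ... | false = there (expo-suc⇒Joins P e)

  expo-head : ∀ a b (R : Mon m) → expo ((a , b) ∷ R) a b ≡ suc (expo R a b)
  expo-head a b R rewrite ==-refl a | ==-refl b = refl

  expo-tail : ∀ c {R R′ : Mon m} {i j} →
              expo (c ∷ R) i j ≡ expo (c ∷ R′) i j → expo R i j ≡ expo R′ i j
  expo-tail c {i = i} {j} e with joins i j c
  ... | true  = ℕₚ.suc-injective e
  ... | false = e

  standard-partner : ∀ {a b b′ R} → toℕ a < toℕ b → IsStandard ((a , b′) ∷ R) →
                     Joins a b ((a , b′) ∷ R) → b′ ≡ b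
  standard-partner {a} {b} a<b s (here c) with joins-true (a , _) c
  ... | inj₁ (_ , b′≡b) = b′≡b
  ... | inj₂ (a≡b , _)  = contradiction (cong toℕ a≡b) (ℕₚ.<⇒≢ a<b)
  standard-partner {R = R} a<b s (there J) =
    ⊥-elim (ℕₚ.<-irrefl refl (All.lookup (standard-above s) (Joins⇒∈ R J)))

  SameExponents : Mon m → Mon m → Set
  SameExponents P P′ = ∀ {i j} → toℕ i < toℕ j → expo P i j ≡ expo P′ i j

  standard-head-Joins : ∀ {a b R P′} → IsStandard ((a , b) ∷ R) →
                        SameExponents ((a , b) ∷ R) P′ → Joins a b P′
  standard-head-Joins {a} {b} {R} s h =
    expo-suc⇒Joins _ (trans (sym (h (standard-head s))) (expo-head a b R))

  -- The first chord of a standard form starts at its least vertex, so the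
  -- exponents determine it.
  standard-unique : ∀ {P P′ : Mon m} → IsStandard P → IsStandard P′ → SameExponents P P′ → P ≡ P′
  standard-unique {[]}          {[]}             _ _  _ = refl
  standard-unique {[]}          {(a , b) ∷ R}    _ s′ h
    with () ← trans (h (standard-head s′)) (expo-head a b R)
  standard-unique {(a , b) ∷ R} {[]}             s _  h
    with () ← trans (sym (h (standard-head s))) (expo-head a b R)
  standard-unique {(a , b) ∷ R} {(a′ , b′) ∷ R′} s s′ h
    with Finₚ.toℕ-injective {i = a′} {j = a} (ℕₚ.≤-antisym
           (standard-lower s′ (Joins⇒∈ _ (standard-head-Joins s h)))
           (standard-lower s  (Joins⇒∈ _ (standard-head-Joins s′ (sym ∘ h)))))
  ... | refl with standard-partner {b = b} {b′ = b′} (standard-head s) s′ (standard-head-Joins s h)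
  ... | refl = cong ((a , b) ∷_)
    (standard-unique (standard-tail s) (standard-tail s′)
                     (λ i<j → expo-tail (a , b) {R} {R′} (h i<j)))

module _ (n : ℕ) where

  ∈-spfFilter⁻ : ∀ πs {π} → π ∈ spfFilter n πs → π ∈ πs × IsStandard (pairsOf π)
  ∈-spfFilter⁻ (π′ ∷ πs) π∈ with isPfPairs (pairsOf π′) in pf?
  ∈-spfFilter⁻ (π′ ∷ πs) (here refl) | true = here refl , standard pf?
  ∈-spfFilter⁻ (π′ ∷ πs) (there π∈)  | true = Product.map₁ there (∈-spfFilter⁻ πs π∈)
  ... | false = Product.map₁ there (∈-spfFilter⁻ πs π∈)

  ∈-spfFilter⁺ : ∀ πs {π} → π ∈ πs → IsStandard (pairsOf π) → π ∈ spfFilter n πs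
  ∈-spfFilter⁺ (π′ ∷ πs) (here refl) (standard pf) rewrite pf = here refl
  ∈-spfFilter⁺ (π′ ∷ πs) (there π∈) s with isPfPairs (pairsOf π′)
  ... | true  = there (∈-spfFilter⁺ πs π∈ s)
  ... | false = ∈-spfFilter⁺ πs π∈ s

  spfFilter-unique : ∀ πs → Unique πs → Unique (spfFilter n πs)
  spfFilter-unique []        _           = []
  spfFilter-unique (π ∷ πs) (π∉πs ∷ u) with isPfPairs (pairsOf π)
  ... | true  = All.tabulate (All.lookup π∉πs ∘ proj₁ ∘ ∈-spfFilter⁻ πs) ∷ spfFilter-unique πs u
  ... | false = spfFilter-unique πs u

  ∈-Spf⁻ : ∀ {π} → π ∈ Spf n → π ↭ allFin (2 * n) × IsStandard (pairsOf π)
  ∈-Spf⁻ π∈ rewrite Spf≡spfFilter n = Product.map₁ (∈-perms⇒↭ _) (∈-spfFilter⁻ _ π∈)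

  ∈-Spf⁺ : ∀ {π} → π ↭ allFin (2 * n) → IsStandard (pairsOf π) → π ∈ Spf n
  ∈-Spf⁺ π↭ s rewrite Spf≡spfFilter n = ∈-spfFilter⁺ _ (↭⇒∈-perms _ π↭) s

  Spf-unique : Unique (Spf n)
  Spf-unique rewrite Spf≡spfFilter n =
    spfFilter-unique _ (perms-unique Finₚ._≟_ _ (Uniqueₚ.allFin⁺ (2 * n)))

between : ℕ → ℕ → ℕ → Bool
between a b x = ((a <ᵇ x) ∧ (x <ᵇ b)) ∨ ((b <ᵇ x) ∧ (x <ᵇ a))

separates : ℕ → ℕ → ℕ → ℕ → Bool
separates a b c d = between a b c xor between a b d

between-sym : ∀ a b x → between b a x ≡ between a b x
between-sym a b x = Boolₚ.∨-comm ((b <ᵇ x) ∧ (x <ᵇ a)) ((a <ᵇ x) ∧ (x <ᵇ b))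

module Xor = CommutativeSemigroupₚ
  (CommutativeRing.+-commutativeSemigroup Boolₚ.xor-∧-commutativeRing)

module _ {m : ℕ} where

  -- For four distinct endpoints, separates is already symmetric in the two
  -- chords; the conjunction makes crosses symmetric for all arguments.
  crosses : Fin m × Fin m → Fin m × Fin m → Bool
  crosses (a , b) (c , d) =
    separates (toℕ a) (toℕ b) (toℕ c) (toℕ d) ∧ separates (toℕ c) (toℕ d) (toℕ a) (toℕ b)

  crossingsWith : Fin m × Fin m → Mon m → Bool
  crossingsWith c []      = false
  crossingsWith c (d ∷ Q) = crosses c d xor crossingsWith c Q

  crossingParity : Mon m → Bool
  crossingParity []      = false
  crossingParity (c ∷ Q) = crossingsWith c Q xor crossingParity Q

  crosses-sym : ∀ c d → crosses c d ≡ crosses d c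
  crosses-sym (a , b) (c , d) = Boolₚ.∧-comm (separates (toℕ a) (toℕ b) (toℕ c) (toℕ d)) _

  crossingsWith-↭ : ∀ c {Q Q′} → Q ↭ Q′ → crossingsWith c Q ≡ crossingsWith c Q′
  crossingsWith-↭ c ↭.refl        = refl
  crossingsWith-↭ c (↭.prep d p)  = cong (crosses c d xor_) (crossingsWith-↭ c p)
  crossingsWith-↭ c (↭.swap d e p) rewrite crossingsWith-↭ c p =
    Xor.x∙yz≈y∙xz (crosses c d) (crosses c e) _
  crossingsWith-↭ c (↭.trans p q) = trans (crossingsWith-↭ c p) (crossingsWith-↭ c q)

  crossingParity-↭ : ∀ {Q Q′} → Q ↭ Q′ → crossingParity Q ≡ crossingParity Q′
  crossingParity-↭ ↭.refl        = refl
  crossingParity-↭ (↭.prep c p)  = cong₂ _xor_ (crossingsWith-↭ c p) (crossingParity-↭ p)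
  crossingParity-↭ (↭.swap c d p)
    rewrite crossingsWith-↭ c p | crossingsWith-↭ d p | crossingParity-↭ p | crosses-sym d c =
    Xor.interchange (crosses c d) _ _ _
  crossingParity-↭ (↭.trans p q) = trans (crossingParity-↭ p) (crossingParity-↭ q)

  crossingParity-map : (F : Fin m × Fin m → Fin m × Fin m) →
                       ∀ Q → AllPairs (λ c d → crosses (F c) (F d) ≡ crosses c d) Q →
                       crossingParity (map F Q) ≡ crossingParity Q
  crossingParity-map F []      []               = refl
  crossingParity-map F (c ∷ Q) (F-c-Q ∷ F-Q) =
    cong₂ _xor_ (crossingsWith-map Q F-c-Q) (crossingParity-map F Q F-Q)
    where
    crossingsWith-map : ∀ Q → All (λ d → crosses (F c) (F d) ≡ crosses c d) Q →
                        crossingsWith (F c) (map F Q) ≡ crossingsWith c Q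
    crossingsWith-map []      []       = refl
    crossingsWith-map (d ∷ Q) (e ∷ es) = cong₂ _xor_ e (crossingsWith-map Q es)

  Distinct : Fin m × Fin m → Fin m × Fin m → Set
  Distinct c d = Unique (flat (c ∷ d ∷ []))

  chords-distinct : ∀ Q → Unique (flat Q) → AllPairs Distinct Q
  chords-distinct []            _                            = []
  chords-distinct ((a , b) ∷ R) ((a≢b ∷ a∉R) ∷ b∉R ∷ u) =
    distinct-from R a∉R b∉R u ∷ chords-distinct R u
    where
    distinct-from : ∀ R → All (a ≢_) (flat R) → All (b ≢_) (flat R) → Unique (flat R) →
                    All (Distinct (a , b)) R
    distinct-from []            _                        _                        _ = []
    distinct-from ((c , d) ∷ R) (a≢c ∷ a≢d ∷ a∉R) (b≢c ∷ b≢d ∷ b∉R) ((c≢d ∷ _) ∷ _ ∷ u) =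
      ((a≢b ∷ a≢c ∷ a≢d ∷ []) ∷ (b≢c ∷ b≢d ∷ []) ∷ (c≢d ∷ []) ∷ [] ∷ [])
      ∷ distinct-from R a∉R b∉R u

-- The sign of a standard form is its crossing parity

even-suc : ∀ n → even (suc n) ≡ not (even n)
even-suc n with even n
... | true  = refl
... | false = refl

odd : ℕ → Bool
odd n = not (even n)

odd-suc : ∀ n → odd (suc n) ≡ not (odd n)
odd-suc n = cong not (even-suc n)

odd-+ : ∀ a b → odd (a + b) ≡ odd a xor odd b
odd-+ zero    b = refl
odd-+ (suc a) b = begin
  odd (suc (a + b))         ≡⟨ odd-suc (a + b) ⟩
  not (odd (a + b))         ≡⟨ cong not (odd-+ a b) ⟩
  not (odd a xor odd b)     ≡⟨ Boolₚ.not-distribˡ-xor (odd a) (odd b) ⟩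
  not (odd a) xor odd b     ≡⟨ cong (_xor odd b) (sym (odd-suc a)) ⟩
  odd (suc a) xor odd b     ∎

odd-if : ∀ t n → odd (if t then suc n else n) ≡ t xor odd n
odd-if true  n = odd-suc n
odd-if false n = refl

chord-parity : ∀ {a b c d} → a < c → c < d → b ≢ c → b ≢ d →
               ((c <ᵇ b) xor (d <ᵇ b)) ≡ (separates a b c d ∧ separates c d a b)
chord-parity {a} {b} {c} {d} a<c c<d b≢c b≢d
  rewrite <ᵇ-true a<c | <ᵇ-false (ℕₚ.<⇒≤ a<c)
        | <ᵇ-true (ℕₚ.<-trans a<c c<d) | <ᵇ-false (ℕₚ.<⇒≤ (ℕₚ.<-trans a<c c<d))
  with ℕₚ.<-cmp b c
... | tri≈ _ b≡c _ = contradiction b≡c b≢c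
... | tri< b<c _ _
  rewrite <ᵇ-true b<c | <ᵇ-false (ℕₚ.<⇒≤ b<c) | <ᵇ-true (ℕₚ.<-trans b<c c<d)
        | <ᵇ-false (ℕₚ.<⇒≤ (ℕₚ.<-trans b<c c<d)) = refl
... | tri> _ _ c<b with ℕₚ.<-cmp b d
...   | tri≈ _ b≡d _ = contradiction b≡d b≢d
...   | tri< b<d _ _
  rewrite <ᵇ-true c<b | <ᵇ-false (ℕₚ.<⇒≤ c<b) | <ᵇ-true b<d | <ᵇ-false (ℕₚ.<⇒≤ b<d) = refl
...   | tri> _ _ d<b
  rewrite <ᵇ-true c<b | <ᵇ-false (ℕₚ.<⇒≤ c<b) | <ᵇ-true d<b = refl

module _ {m : ℕ} where

  countBelow : Fin m → List (Fin m) → ℕ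
  countBelow x = foldr (λ y k → if x >? y then suc k else k) zero

  countBelow-min : ∀ {x} {ys : List (Fin m)} → All (λ y → toℕ x < toℕ y) ys → countBelow x ys ≡ 0
  countBelow-min []             = refl
  countBelow-min (x<y ∷ x<ys) rewrite <ᵇ-false (ℕₚ.<⇒≤ x<y) = countBelow-min x<ys

  odd-countBelow : ∀ {a b : Fin m} R → All (λ x → toℕ a < toℕ x) (flat R) →
                   IsStandard R → All (b ≢_) (flat R) →
                   odd (countBelow b (flat R)) ≡ crossingsWith (a , b) R
  odd-countBelow                 []            _                 _ _ = refl
  odd-countBelow {a} {b} ((c , d) ∷ R) (a<c ∷ _ ∷ a<R) s (b≢c ∷ b≢d ∷ b∉R) = begin
    odd (countBelow b (c ∷ d ∷ flat R))
      ≡⟨ odd-if (b >? c) _ ⟩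
    (b >? c) xor odd (countBelow b (d ∷ flat R))
      ≡⟨ cong ((b >? c) xor_) (odd-if (b >? d) _) ⟩
    (b >? c) xor ((b >? d) xor odd (countBelow b (flat R)))
      ≡⟨ cong (λ t → (b >? c) xor ((b >? d) xor t)) (odd-countBelow R a<R (standard-tail s) b∉R) ⟩
    (b >? c) xor ((b >? d) xor crossingsWith (a , b) R)
      ≡⟨ sym (Boolₚ.xor-assoc (b >? c) (b >? d) _) ⟩
    ((b >? c) xor (b >? d)) xor crossingsWith (a , b) R
      ≡⟨ cong (_xor crossingsWith (a , b) R)
              (chord-parity a<c (standard-head s)
                            (b≢c ∘ Finₚ.toℕ-injective) (b≢d ∘ Finₚ.toℕ-injective)) ⟩
    crossingsWith (a , b) ((c , d) ∷ R) ∎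

  odd-inversions : ∀ (P : Mon m) → IsStandard P → Unique (flat P) →
                   odd (inversions (flat P)) ≡ crossingParity P
  odd-inversions []             _ _                 = refl
  odd-inversions ((a , b) ∷ R) s (_ ∷ b∉R ∷ u) = begin
    odd (countBelow a (b ∷ flat R) + (countBelow b (flat R) + inversions (flat R)))
      ≡⟨ cong (λ k → odd (k + _)) (countBelow-min (standard-head s ∷ standard-above s)) ⟩
    odd (countBelow b (flat R) + inversions (flat R))
      ≡⟨ odd-+ (countBelow b (flat R)) _ ⟩
    odd (countBelow b (flat R)) xor odd (inversions (flat R))
      ≡⟨ cong₂ _xor_ (odd-countBelow R (standard-above s) (standard-tail s) b∉R)
                     (odd-inversions R (standard-tail s) u) ⟩
    crossingParity ((a , b) ∷ R) ∎

  sign-standard : ∀ {c ℓ} (K : CommutativeRing c ℓ) {P P′ : Mon m} →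
                  IsStandard P → Unique (flat P) → IsStandard P′ → Unique (flat P′) →
                  crossingParity P ≡ crossingParity P′ → sign K (flat P) ≡ sign K (flat P′)
  sign-standard K {P} {P′} s u s′ u′ same =
    cong (λ t → if t then 1# else - 1#)
         (Boolₚ.not-injective
           (trans (odd-inversions P s u) (trans same (sym (odd-inversions P′ s′ u′)))))
    where open CommutativeRing K using (1#; -_)

module InsertionSort {A : Set} (key : A → ℕ) where

  insert : A → List A → List A
  insert x []       = x ∷ []
  insert x (y ∷ ys) = if key y <ᵇ key x then y ∷ insert x ys else x ∷ y ∷ ys

  sort : List A → List A
  sort = foldr insert []

  Sorted : List A → Set
  Sorted = AllPairs (λ x y → key x ≤ key y)

  insert-↭ : ∀ x ys → insert x ys ↭ x ∷ ys
  insert-↭ x []       = ↭-refl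
  insert-↭ x (y ∷ ys) with key y <ᵇ key x
  ... | true  = ↭-trans (↭.prep y (insert-↭ x ys)) (↭.swap y x ↭-refl)
  ... | false = ↭-refl

  sort-↭ : ∀ xs → sort xs ↭ xs
  sort-↭ []       = ↭-refl
  sort-↭ (x ∷ xs) = ↭-trans (insert-↭ x (sort xs)) (↭.prep x (sort-↭ xs))

  insert-sorted : ∀ x {ys} → Sorted ys → Sorted (insert x ys)
  insert-sorted x {[]}     _ = [] ∷ []
  insert-sorted x {y ∷ ys} (y≤ys ∷ sorted) with key y <ᵇ key x | ℕₚ.<ᵇ-reflects-< (key y) (key x)
  ... | true  | ofʸ y<x =
    ↭ₚ.All-resp-↭ (↭-sym (insert-↭ x ys)) (ℕₚ.<⇒≤ y<x ∷ y≤ys) ∷ insert-sorted x sorted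
  ... | false | ofⁿ y≮x =
    let x≤y = ℕₚ.≮⇒≥ y≮x in (x≤y ∷ All.map (ℕₚ.≤-trans x≤y) y≤ys) ∷ y≤ys ∷ sorted

  sort-sorted : ∀ xs → Sorted (sort xs)
  sort-sorted []       = []
  sort-sorted (x ∷ xs) = insert-sorted x (sort-sorted xs)

module _ {m : ℕ} where

  orient : Fin m × Fin m → Fin m × Fin m
  orient (p , q) = if toℕ q <ᵇ toℕ p then (q , p) else (p , q)

  orient-cases : ∀ c → orient c ≡ c ⊎ orient c ≡ Product.swap c
  orient-cases (p , q) with toℕ q <ᵇ toℕ p
  ... | true  = inj₂ refl
  ... | false = inj₁ refl

  orient-≤ : ∀ c → toℕ (proj₁ (orient c)) ≤ toℕ (proj₂ (orient c))
  orient-≤ (p , q) with toℕ q <ᵇ toℕ p | ℕₚ.<ᵇ-reflects-< (toℕ q) (toℕ p)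
  ... | true  | ofʸ q<p = ℕₚ.<⇒≤ q<p
  ... | false | ofⁿ q≮p = ℕₚ.≮⇒≥ q≮p

  flat-orient : ∀ Q → flat (map orient Q) ↭ flat Q
  flat-orient []            = ↭-refl
  flat-orient ((p , q) ∷ Q) with orient-cases (p , q)
  ... | inj₁ eq rewrite eq = ↭.prep p (↭.prep q (flat-orient Q))
  ... | inj₂ eq rewrite eq = ↭.swap q p (flat-orient Q)

  joins-orient : ∀ i j c → joins i j (orient c) ≡ joins i j c
  joins-orient i j c with orient-cases c
  ... | inj₁ eq rewrite eq = refl
  ... | inj₂ eq rewrite eq = joins-swap i j c

  crosses-swapˡ : ∀ (c d : Fin m × Fin m) → crosses (Product.swap c) d ≡ crosses c d
  crosses-swapˡ (p , q) (r , s) =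
    cong₂ _∧_ (cong₂ _xor_ (between-sym (toℕ p) (toℕ q) (toℕ r))
                           (between-sym (toℕ p) (toℕ q) (toℕ s)))
              (Boolₚ.xor-comm (between (toℕ r) (toℕ s) (toℕ q)) (between (toℕ r) (toℕ s) (toℕ p)))

  crosses-swapʳ : ∀ (c d : Fin m × Fin m) → crosses c (Product.swap d) ≡ crosses c d
  crosses-swapʳ c d =
    trans (crosses-sym c (Product.swap d)) (trans (crosses-swapˡ d c) (crosses-sym d c))

  crosses-orient : ∀ c d → crosses (orient c) (orient d) ≡ crosses c d
  crosses-orient c d with orient-cases c | orient-cases d
  ... | inj₁ eq | inj₁ eq′ rewrite eq | eq′ = refl
  ... | inj₁ eq | inj₂ eq′ rewrite eq | eq′ = crosses-swapʳ c d
  ... | inj₂ eq | inj₁ eq′ rewrite eq | eq′ = crosses-swapˡ c d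
  ... | inj₂ eq | inj₂ eq′ rewrite eq | eq′ =
    trans (crosses-swapˡ c (Product.swap d)) (crosses-swapʳ c d)

  open InsertionSort {A = Fin m × Fin m} (toℕ ∘ proj₁) using (sort; sort-↭; sort-sorted; Sorted)

  sorted⇒standard : ∀ P → Sorted P → All (λ c → toℕ (proj₁ c) ≤ toℕ (proj₂ c)) P →
                    Unique (flat P) → IsStandard P
  sorted⇒standard []                      _                  _              _ = standard refl
  sorted⇒standard ((a , b) ∷ [])          _                  (a≤b ∷ _)      ((a≢b ∷ _) ∷ _) =
    standard (<ᵇ-true (ℕₚ.≤∧≢⇒< a≤b (a≢b ∘ Finₚ.toℕ-injective)))
  sorted⇒standard ((a , b) ∷ (c , d) ∷ R) ((a≤c ∷ _) ∷ sorted) (a≤b ∷ oriented)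
                  ((a≢b ∷ a≢c ∷ _) ∷ _ ∷ u) =
    standard-∷∷⁺ (ℕₚ.≤∧≢⇒< a≤b (a≢b ∘ Finₚ.toℕ-injective)) (ℕₚ.≤∧≢⇒< a≤c (a≢c ∘ Finₚ.toℕ-injective))
                 (sorted⇒standard ((c , d) ∷ R) sorted oriented u)

  record StandardForm (Q : Mon m) : Set where
    field
      form        : Mon m
      isStandard  : IsStandard form
      flat↭       : flat form ↭ flat Q
      expo≡       : ∀ i j → expo form i j ≡ expo Q i j
      parity≡     : crossingParity form ≡ crossingParity Q

  standardForm : ∀ Q → Unique (flat Q) → StandardForm Q
  standardForm Q uniq = record
    { form       = sort O
    ; isStandard = sorted⇒standard (sort O) (sort-sorted O)
                     (↭ₚ.All-resp-↭ (↭-sym (sort-↭ O)) (Allₚ.map⁺ (All.universal orient-≤ Q)))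
                     (unique-↭ (↭-sym flat↭) uniq)
    ; flat↭      = flat↭
    ; expo≡      = λ i j → trans (expo-↭ (sort-↭ O) i j) (expo-map orient (joins-orient i j) Q)
    ; parity≡    = trans (crossingParity-↭ (sort-↭ O))
                         (crossingParity-map orient Q orient-crossings)
    }
    where
    orient-crossings : AllPairs (λ c d → crosses (orient c) (orient d) ≡ crosses c d) Q
    orient-crossings = AllPairs.map (λ {c} {d} _ → crosses-orient c d) (chords-distinct Q uniq)
    O : Mon m
    O = map orient Q
    flat↭ : flat (sort O) ↭ flat Q
    flat↭ = ↭-trans (flat-↭ (sort-↭ O)) (flat-orient Q)

-- Symmetries of the polygon preserve crossings

-- Reading {0, …, M-1} as points on a circle cut open at z, a map φ that
-- preserves `between` away from z, and reverses it for chords from z,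
-- preserves `separates`: when z is an endpoint, the two reversals cancel.
module SeparationInvariance
  (φ : ℕ → ℕ) (M z : ℕ)
  (away : ∀ {a b x} → a < M → b < M → x < M → a ≢ z → b ≢ z → x ≢ z →
          between (φ a) (φ b) (φ x) ≡ between a b x)
  (to-z : ∀ {a b} → a < M → b < M → a ≢ z → b ≢ z →
          between (φ a) (φ b) (φ z) ≡ between a b z)
  (from-z : ∀ {b x} → b < M → x < M → b ≢ z → x ≢ z → b ≢ x →
            between (φ z) (φ b) (φ x) ≡ not (between z b x))
  where

  from-z′ : ∀ {a x} → a < M → x < M → a ≢ z → x ≢ z → a ≢ x →
            between (φ a) (φ z) (φ x) ≡ not (between a z x)
  from-z′ {a} {x} a<M x<M a≢z x≢z a≢x = begin
    between (φ a) (φ z) (φ x)  ≡⟨ between-sym (φ z) (φ a) (φ x) ⟩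
    between (φ z) (φ a) (φ x)  ≡⟨ from-z a<M x<M a≢z x≢z a≢x ⟩
    not (between z a x)        ≡⟨ cong not (between-sym a z x) ⟩
    not (between a z x)        ∎

  separates-invariant : ∀ {a b c d} → a < M → b < M → c < M → d < M → Unique (a ∷ b ∷ c ∷ d ∷ []) →
                        separates (φ a) (φ b) (φ c) (φ d) ≡ separates a b c d
  separates-invariant {a} {b} {c} {d} a<M b<M c<M d<M
    ((a≢b ∷ a≢c ∷ a≢d ∷ []) ∷ (b≢c ∷ b≢d ∷ []) ∷ (c≢d ∷ []) ∷ [] ∷ [])
    with a ℕₚ.≟ z | b ℕₚ.≟ z | c ℕₚ.≟ z | d ℕₚ.≟ z
  ... | yes refl | _ | _ | _ =
    trans (cong₂ _xor_ (from-z b<M c<M (a≢b ∘ sym) (a≢c ∘ sym) b≢c)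
                       (from-z b<M d<M (a≢b ∘ sym) (a≢d ∘ sym) b≢d))
          (Boolₚ.xor-annihilates-not (between a b c) (between a b d))
  ... | no a≢z | yes refl | _ | _ =
    trans (cong₂ _xor_ (from-z′ a<M c<M a≢z (b≢c ∘ sym) a≢c)
                       (from-z′ a<M d<M a≢z (b≢d ∘ sym) a≢d))
          (Boolₚ.xor-annihilates-not (between a b c) (between a b d))
  ... | no a≢z | no b≢z | yes refl | _ =
    cong₂ _xor_ (to-z a<M b<M a≢z b≢z) (away a<M b<M d<M a≢z b≢z (c≢d ∘ sym))
  ... | no a≢z | no b≢z | no c≢z | yes refl =
    cong₂ _xor_ (away a<M b<M c<M a≢z b≢z c≢z) (to-z a<M b<M a≢z b≢z)
  ... | no a≢z | no b≢z | no c≢z | no d≢z =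
    cong₂ _xor_ (away a<M b<M c<M a≢z b≢z c≢z) (away a<M b<M d<M a≢z b≢z d≢z)

shiftℕ : ℕ → ℕ → ℕ
shiftℕ m′ x = if x ≡ᵇ m′ then 0 else suc x

reflℕ : ℕ → ℕ → ℕ
reflℕ m′ x = if x ≡ᵇ 0 then 0 else suc m′ ∸ x

module Shift (m′ : ℕ) where
  away : ∀ {a b x} → a < suc m′ → b < suc m′ → x < suc m′ → a ≢ m′ → b ≢ m′ → x ≢ m′ →
         between (shiftℕ m′ a) (shiftℕ m′ b) (shiftℕ m′ x) ≡ between a b x
  away _ _ _ a≢m′ b≢m′ x≢m′ rewrite ≡ᵇ-false a≢m′ | ≡ᵇ-false b≢m′ | ≡ᵇ-false x≢m′ = refl

  to-z : ∀ {a b} → a < suc m′ → b < suc m′ → a ≢ m′ → b ≢ m′ →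
         between (shiftℕ m′ a) (shiftℕ m′ b) (shiftℕ m′ m′) ≡ between a b m′
  to-z {a} {b} a<M b<M a≢m′ b≢m′
    rewrite ≡ᵇ-false a≢m′ | ≡ᵇ-false b≢m′ | ≡ᵇ-refl m′
          | <ᵇ-false (ℕₚ.≤-pred a<M) | <ᵇ-false (ℕₚ.≤-pred b<M)
          | Boolₚ.∧-zeroʳ (a <ᵇ m′) | Boolₚ.∧-zeroʳ (b <ᵇ m′) = refl

  from-z : ∀ {b x} → b < suc m′ → x < suc m′ → b ≢ m′ → x ≢ m′ → b ≢ x →
           between (shiftℕ m′ m′) (shiftℕ m′ b) (shiftℕ m′ x) ≡ not (between m′ b x)
  from-z {b} {x} _ x<M b≢m′ x≢m′ b≢x
    rewrite ≡ᵇ-false b≢m′ | ≡ᵇ-false x≢m′ | ≡ᵇ-refl m′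
          | <ᵇ-false (ℕₚ.≤-pred x<M) | <ᵇ-true (ℕₚ.≤∧≢⇒< (ℕₚ.≤-pred x<M) x≢m′)
    with ℕₚ.<-cmp b x
  ... | tri< b<x _ _ rewrite <ᵇ-true b<x | <ᵇ-false (ℕₚ.<⇒≤ b<x) = refl
  ... | tri≈ _ b≡x _ = contradiction b≡x b≢x
  ... | tri> _ _ x<b rewrite <ᵇ-true x<b | <ᵇ-false (ℕₚ.<⇒≤ x<b) = refl

  open SeparationInvariance (shiftℕ m′) (suc m′) m′ away to-z from-z public
    using (separates-invariant)

∸-<ᵇ : ∀ M {a x} → a ≤ M → x ≤ M → ((M ∸ a) <ᵇ (M ∸ x)) ≡ (x <ᵇ a)
∸-<ᵇ M {a} {x} a≤M x≤M with ℕₚ.<-cmp x a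
... | tri< x<a _ _ rewrite <ᵇ-true x<a = <ᵇ-true (ℕₚ.∸-monoʳ-< x<a a≤M)
... | tri≈ _ refl _ rewrite <ᵇ-false (ℕₚ.≤-refl {x}) = <ᵇ-false (ℕₚ.≤-refl {M ∸ x})
... | tri> _ _ a<x rewrite <ᵇ-false (ℕₚ.<⇒≤ a<x) = <ᵇ-false (ℕₚ.∸-monoʳ-≤ M (ℕₚ.<⇒≤ a<x))

module Reflection (m′ : ℕ) where
  private
    M = suc m′

  away : ∀ {a b x} → a < M → b < M → x < M → a ≢ 0 → b ≢ 0 → x ≢ 0 →
         between (reflℕ m′ a) (reflℕ m′ b) (reflℕ m′ x) ≡ between a b x
  away {a} {b} {x} a<M b<M x<M a≢0 b≢0 x≢0
    rewrite ≡ᵇ-false a≢0 | ≡ᵇ-false b≢0 | ≡ᵇ-false x≢0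
          | ∸-<ᵇ M (ℕₚ.<⇒≤ a<M) (ℕₚ.<⇒≤ x<M) | ∸-<ᵇ M (ℕₚ.<⇒≤ x<M) (ℕₚ.<⇒≤ b<M)
          | ∸-<ᵇ M (ℕₚ.<⇒≤ b<M) (ℕₚ.<⇒≤ x<M) | ∸-<ᵇ M (ℕₚ.<⇒≤ x<M) (ℕₚ.<⇒≤ a<M)
          | Boolₚ.∧-comm (x <ᵇ a) (b <ᵇ x) | Boolₚ.∧-comm (x <ᵇ b) (a <ᵇ x)
    = Boolₚ.∨-comm ((b <ᵇ x) ∧ (x <ᵇ a)) ((a <ᵇ x) ∧ (x <ᵇ b))

  from-z : ∀ {b x} → b < M → x < M → b ≢ 0 → x ≢ 0 → b ≢ x →
           between (reflℕ m′ 0) (reflℕ m′ b) (reflℕ m′ x) ≡ not (between 0 b x)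
  from-z {b} {x} b<M x<M b≢0 x≢0 b≢x
    rewrite ≡ᵇ-false b≢0 | ≡ᵇ-false x≢0
          | <ᵇ-true (ℕₚ.m<n⇒0<n∸m x<M)
          | ∸-<ᵇ M (ℕₚ.<⇒≤ x<M) (ℕₚ.<⇒≤ b<M) | ∸-<ᵇ M (ℕₚ.<⇒≤ b<M) (ℕₚ.<⇒≤ x<M)
          | <ᵇ-true {0} {x} (ℕₚ.n≢0⇒n>0 x≢0)
    with ℕₚ.<-cmp b x
  ... | tri< b<x _ _ rewrite <ᵇ-true b<x | <ᵇ-false (ℕₚ.<⇒≤ b<x) = refl
  ... | tri≈ _ b≡x _ = contradiction b≡x b≢x
  ... | tri> _ _ x<b rewrite <ᵇ-true x<b | <ᵇ-false (ℕₚ.<⇒≤ x<b) = refl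

  open SeparationInvariance (reflℕ m′) M 0 away (λ _ _ _ _ → refl) from-z public
    using (separates-invariant)

toℕ-shiftF : ∀ m′ (i : Fin (suc m′)) → toℕ (shiftF (suc m′) i) ≡ shiftℕ m′ (toℕ i)
toℕ-shiftF m′ i rewrite Finₚ.toℕ-fromℕ< (DivMod.m%n<n (suc (toℕ i)) (suc m′))
  with toℕ i ≡ᵇ m′ | ≡ᵇ-reflects-≡ (toℕ i) m′
... | true  | ofʸ i≡m′ rewrite i≡m′ = DivMod.n%n≡0 (suc m′)
... | false | ofⁿ i≢m′ = DivMod.m≤n⇒m%n≡m (ℕₚ.≤∧≢⇒< (ℕₚ.≤-pred (Finₚ.toℕ<n i)) i≢m′)

toℕ-reflF : ∀ m′ (i : Fin (suc m′)) → toℕ (reflF (suc m′) i) ≡ reflℕ m′ (toℕ i)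
toℕ-reflF m′ i rewrite Finₚ.toℕ-fromℕ< (DivMod.m%n<n (suc m′ ∸ toℕ i) (suc m′))
  with toℕ i ≡ᵇ 0 | ≡ᵇ-reflects-≡ (toℕ i) 0
... | true  | ofʸ i≡0 rewrite i≡0 = DivMod.n%n≡0 (suc m′)
... | false | ofⁿ i≢0 = DivMod.m≤n⇒m%n≡m
  (ℕₚ.≤-pred (ℕₚ.∸-monoʳ-< (ℕₚ.n≢0⇒n>0 i≢0) (ℕₚ.<⇒≤ (Finₚ.toℕ<n i))))

module _ {m : ℕ} where

  PreservesCrossings : (Fin m → Fin m) → Set
  PreservesCrossings f = ∀ c d → Distinct c d → crosses (both f c) (both f d) ≡ crosses c d

  preservesCrossings-≗ : ∀ {f g} → (∀ x → f x ≡ g x) → PreservesCrossings f → PreservesCrossings g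
  preservesCrossings-≗ {f} {g} f≗g pf c d cd =
    trans (sym (cong₂ crosses (both-≗ c) (both-≗ d))) (pf c d cd)
    where
    both-≗ : ∀ c → both f c ≡ both g c
    both-≗ (p , q) = cong₂ _,_ (f≗g p) (f≗g q)

  preservesCrossings-∘ : ∀ {f g} → (∀ {x y} → g x ≡ g y → x ≡ y) →
                         PreservesCrossings f → PreservesCrossings g → PreservesCrossings (f ∘ g)
  preservesCrossings-∘ {g = g} g-inj pf pg c d cd =
    trans (pf (both g c) (both g d) (Uniqueₚ.map⁺ g-inj cd)) (pg c d cd)

  preservesCrossings-inverse : ∀ {f g} → (∀ x → f (g x) ≡ x) →
                               PreservesCrossings f → PreservesCrossings g
  preservesCrossings-inverse {f} {g} f∘g pf c d cd =
    trans (sym (pf (both g c) (both g d) (Uniqueₚ.map⁺ g-inj cd)))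
          (cong₂ crosses (f∘g-both c) (f∘g-both d))
    where
    g-inj : ∀ {x y} → g x ≡ g y → x ≡ y
    g-inj {x} {y} gx≡gy = trans (sym (f∘g x)) (trans (cong f gx≡gy) (f∘g y))
    f∘g-both : ∀ c → both f (both g c) ≡ c
    f∘g-both (p , q) = cong₂ _,_ (f∘g p) (f∘g q)

  crossingParity-preserved : ∀ {f} → PreservesCrossings f → ∀ Q → Unique (flat Q) →
                             crossingParity (map (both f) Q) ≡ crossingParity Q
  crossingParity-preserved pf Q uniq =
    crossingParity-map (both _) Q (AllPairs.map (λ {c} {d} → pf c d) (chords-distinct Q uniq))

preservesCrossings-ℕ : ∀ {M} (f : Fin M → Fin M) (φ : ℕ → ℕ) → (∀ x → toℕ (f x) ≡ φ (toℕ x)) →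
  (∀ {a b c d} → a < M → b < M → c < M → d < M → Unique (a ∷ b ∷ c ∷ d ∷ []) →
   separates (φ a) (φ b) (φ c) (φ d) ≡ separates a b c d) →
  PreservesCrossings f
preservesCrossings-ℕ f φ f≈φ sep (a , b) (c , d) abcd
  rewrite f≈φ a | f≈φ b | f≈φ c | f≈φ d =
  cong₂ _∧_ (sep <M <M <M <M abcdℕ)
            (sep <M <M <M <M (unique-↭ (↭ₚ.shifts (toℕ a ∷ toℕ b ∷ []) (toℕ c ∷ toℕ d ∷ [])) abcdℕ))
  where
  abcdℕ = Uniqueₚ.map⁺ Finₚ.toℕ-injective abcd
  <M : ∀ {x} → toℕ x < _
  <M {x} = Finₚ.toℕ<n x

InD⇒preservesCrossings : ∀ {m μ} → InD m μ → PreservesCrossings (μ ⟨$⟩ʳ_)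
InD⇒preservesCrossings {zero}   _ (() , _) _ _
InD⇒preservesCrossings {suc m′} (gen-shift ρ ρ≗shift) =
  preservesCrossings-≗ (sym ∘ ρ≗shift)
    (preservesCrossings-ℕ (shiftF (suc m′)) (shiftℕ m′) (toℕ-shiftF m′)
                          (Shift.separates-invariant m′))
InD⇒preservesCrossings {suc m′} (gen-refl ρ ρ≗refl) =
  preservesCrossings-≗ (sym ∘ ρ≗refl)
    (preservesCrossings-ℕ (reflF (suc m′)) (reflℕ m′) (toℕ-reflF m′)
                          (Reflection.separates-invariant m′))
InD⇒preservesCrossings {suc m′} d-id = λ _ _ _ → refl
InD⇒preservesCrossings {suc m′} (d-comp {ρ} {σ} ρ∈D σ∈D) =
  preservesCrossings-∘ {f = σ ⟨$⟩ʳ_} {g = ρ ⟨$⟩ʳ_} (⟨$⟩ʳ-injective ρ)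
    (InD⇒preservesCrossings σ∈D) (InD⇒preservesCrossings ρ∈D)
InD⇒preservesCrossings {suc m′} (d-inv {ρ} ρ∈D) =
  preservesCrossings-inverse {f = ρ ⟨$⟩ʳ_} {g = ρ ⟨$⟩ˡ_} (λ _ → inverseʳ ρ)
    (InD⇒preservesCrossings ρ∈D)

module _ {m : ℕ} where

  map-allFin-↭ : (σ : Permutation m m) → map (σ ⟨$⟩ˡ_) (allFin m) ↭ allFin m
  map-allFin-↭ σ = ∼bag⇒↭ (unique∧set⇒bag
    (Uniqueₚ.map⁺ (⟨$⟩ˡ-injective σ) (Uniqueₚ.allFin⁺ m)) (Uniqueₚ.allFin⁺ m)
    (λ {v} → mk⇔ (λ _ → ∈ₚ.∈-allFin v) (λ _ → ∈-image v)))
    where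
    ∈-image : ∀ v → v ∈ map (σ ⟨$⟩ˡ_) (allFin m)
    ∈-image v = subst (_∈ map (σ ⟨$⟩ˡ_) (allFin m)) (inverseˡ σ)
                      (∈ₚ.∈-map⁺ (σ ⟨$⟩ˡ_) (∈ₚ.∈-allFin (σ ⟨$⟩ʳ v)))

  flat-both : ∀ (f : Fin m → Fin m) P → flat (map (both f) P) ≡ map f (flat P)
  flat-both f []            = refl
  flat-both f ((a , b) ∷ P) = cong (λ t → f a ∷ f b ∷ t) (flat-both f P)

module _ (n : ℕ) where

  private
    Vertex = Fin (2 * n)

  Spf-flat : ∀ {π} → π ∈ Spf n → flat (pairsOf π) ≡ π
  Spf-flat {π} π∈ = flat-pairsOf n π (begin
    length π                ≡⟨ ↭ₚ.↭-length (proj₁ (∈-Spf⁻ n π∈)) ⟩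
    length (allFin (2 * n)) ≡⟨ Listₚ.length-tabulate id ⟩
    n + (n + 0)             ≡⟨ cong (n +_) (ℕₚ.+-identityʳ n) ⟩
    n + n                   ∎)

  Spf-standard : ∀ {π} → π ∈ Spf n → IsStandard (pairsOf π)
  Spf-standard π∈ = proj₂ (∈-Spf⁻ n π∈)

  Spf-flat-unique : ∀ {π} → π ∈ Spf n → Unique (flat (pairsOf π))
  Spf-flat-unique π∈ rewrite Spf-flat π∈ =
    unique-↭ (↭-sym (proj₁ (∈-Spf⁻ n π∈))) (Uniqueₚ.allFin⁺ (2 * n))

  Spf-injective : ∀ {π π′} → π ∈ Spf n → π′ ∈ Spf n →
                  SameExponents (pairsOf π) (pairsOf π′) → π ≡ π′
  Spf-injective π∈ π′∈ same =
    trans (sym (Spf-flat π∈))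
          (trans (cong flat (standard-unique (Spf-standard π∈) (Spf-standard π′∈) same))
                 (Spf-flat π′∈))

  Spf-hasExp-injective : ∀ {π π′ e} → π ∈ Spf n → π′ ∈ Spf n →
                         hasExp (pairsOf π) e ≡ true → hasExp (pairsOf π′) e ≡ true → π ≡ π′
  Spf-hasExp-injective {π} {π′} {e} π∈ π′∈ has has′ = Spf-injective π∈ π′∈ λ i<j →
    trans (hasExp⇒expo (pairsOf π) e has i<j) (sym (hasExp⇒expo (pairsOf π′) e has′ i<j))

  record Relabelling (σ : Permutation (2 * n) (2 * n)) (π : List Vertex) : Set where
    field
      image   : List Vertex
      image∈  : image ∈ Spf n
      expo≡   : ∀ i j → expo (pairsOf image) i j ≡ expo (pairsOf π) (σ ⟨$⟩ʳ i) (σ ⟨$⟩ʳ j)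
      parity≡ : crossingParity (pairsOf image) ≡ crossingParity (map (both (σ ⟨$⟩ˡ_)) (pairsOf π))

  relabel : ∀ σ {π} → π ∈ Spf n → Relabelling σ π
  relabel σ {π} π∈ = record
    { image   = flat form
    ; image∈  = ∈-Spf⁺ n image↭ (subst IsStandard (sym (pairsOf-flat form)) isStandard)
    ; expo≡   = λ i j → begin
        expo (pairsOf (flat form)) i j          ≡⟨ cong (λ P → expo P i j) (pairsOf-flat form) ⟩
        expo form i j                           ≡⟨ expo≡ i j ⟩
        expo Q i j                              ≡⟨ expo-relabel σ (pairsOf π) i j ⟩
        expo (pairsOf π) (σ ⟨$⟩ʳ i) (σ ⟨$⟩ʳ j) ∎
    ; parity≡ = trans (cong crossingParity (pairsOf-flat form)) parity≡
    }
    where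
    Q : Mon (2 * n)
    Q = map (both (σ ⟨$⟩ˡ_)) (pairsOf π)
    flatQ≡ : flat Q ≡ map (σ ⟨$⟩ˡ_) π
    flatQ≡ = trans (flat-both (σ ⟨$⟩ˡ_) (pairsOf π)) (cong (map (σ ⟨$⟩ˡ_)) (Spf-flat π∈))
    flatQ↭ : flat Q ↭ allFin (2 * n)
    flatQ↭ rewrite flatQ≡ = ↭-trans (↭ₚ.map⁺ (σ ⟨$⟩ˡ_) (proj₁ (∈-Spf⁻ n π∈))) (map-allFin-↭ σ)
    open StandardForm (standardForm Q (unique-↭ (↭-sym flatQ↭) (Uniqueₚ.allFin⁺ (2 * n))))
    image↭ : flat form ↭ allFin (2 * n)
    image↭ = ↭-trans flat↭ flatQ↭

  module _ {σ : Permutation (2 * n) (2 * n)} where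
    open Relabelling

    relabel-injective : ∀ {π π′} → π ∈ Spf n → π′ ∈ Spf n →
                        (r : Relabelling σ π) (r′ : Relabelling σ π′) → image r ≡ image r′ → π ≡ π′
    relabel-injective {π} {π′} π∈ π′∈ r r′ same = Spf-injective π∈ π′∈ λ {a} {b} _ → begin
      expo (pairsOf π) a b
        ≡⟨ sym (cong₂ (expo (pairsOf π)) (inverseʳ σ) (inverseʳ σ)) ⟩
      expo (pairsOf π) (σ ⟨$⟩ʳ (σ ⟨$⟩ˡ a)) (σ ⟨$⟩ʳ (σ ⟨$⟩ˡ b))
        ≡⟨ sym (expo≡ r _ _) ⟩
      expo (pairsOf (image r)) (σ ⟨$⟩ˡ a) (σ ⟨$⟩ˡ b)
        ≡⟨ cong (λ π → expo (pairsOf π) (σ ⟨$⟩ˡ a) (σ ⟨$⟩ˡ b)) same ⟩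
      expo (pairsOf (image r′)) (σ ⟨$⟩ˡ a) (σ ⟨$⟩ˡ b)
        ≡⟨ expo≡ r′ _ _ ⟩
      expo (pairsOf π′) (σ ⟨$⟩ʳ (σ ⟨$⟩ˡ a)) (σ ⟨$⟩ʳ (σ ⟨$⟩ˡ b))
        ≡⟨ cong₂ (expo (pairsOf π′)) (inverseʳ σ) (inverseʳ σ) ⟩
      expo (pairsOf π′) a b ∎

    relabel-sign : ∀ {c ℓ} (K : CommutativeRing c ℓ) → InD (2 * n) σ →
                   ∀ {π} → π ∈ Spf n → (r : Relabelling σ π) → sign K (image r) ≡ sign K π
    relabel-sign K σ∈D {π} π∈ r = begin
      sign K (image r)                  ≡⟨ cong (sign K) (sym (Spf-flat (image∈ r))) ⟩
      sign K (flat (pairsOf (image r)))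
        ≡⟨ sign-standard K (Spf-standard (image∈ r)) (Spf-flat-unique (image∈ r))
                           (Spf-standard π∈) (Spf-flat-unique π∈) parity ⟩
      sign K (flat (pairsOf π))         ≡⟨ cong (sign K) (Spf-flat π∈) ⟩
      sign K π                          ∎
      where
      parity : crossingParity (pairsOf (image r)) ≡ crossingParity (pairsOf π)
      parity = trans (parity≡ r)
        (crossingParity-preserved (InD⇒preservesCrossings (d-inv σ∈D))
                                  (pairsOf π) (Spf-flat-unique π∈))

module Invariance {c ℓ} (K : CommutativeRing c ℓ) (n : ℕ)
                  (μ : Permutation (2 * n) (2 * n)) (μ∈D : InD (2 * n) μ)
                  (e : Fin (2 * n) → Fin (2 * n) → ℕ) where
  open CommutativeRing K using (Carrier; _≈_)
    renaming (trans to ≈-trans; sym to ≈-sym; reflexive to ≈-reflexive)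
  open Relabelling

  term : List (Fin (2 * n)) → Carrier × Mon (2 * n)
  term π = (sign K π , pairsOf π)

  actedTerm : List (Fin (2 * n)) → Carrier × Mon (2 * n)
  actedTerm π = (sign K π , map (both (μ ⟨$⟩ˡ_)) (pairsOf π))

  act-pf≡ : act {K = K} μ (pf K n) ≡ map actedTerm (Spf n)
  act-pf≡ = sym (Listₚ.map-∘ (Spf n))

  module Pf = Coefficients K e term
  module Act = Coefficients K e actedTerm

  hasExp-relabel : ∀ {π} (π∈ : π ∈ Spf n) → Act.HasExp π → Pf.HasExp (image (relabel n μ π∈))
  hasExp-relabel {π} π∈ hit = trans (hasExp-cong (pairsOf (image r)) Q expo≡′ e) hit
    where
    r = relabel n μ π∈
    Q = map (both (μ ⟨$⟩ˡ_)) (pairsOf π)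
    expo≡′ : ∀ i j → expo (pairsOf (image r)) i j ≡ expo Q i j
    expo≡′ i j = trans (expo≡ r i j) (sym (expo-relabel μ (pairsOf π) i j))

  hasExp-relabel⁻¹ : ∀ {π} (π∈ : π ∈ Spf n) → Pf.HasExp π → Act.HasExp (image (relabel n (flip μ) π∈))
  hasExp-relabel⁻¹ {π} π∈ hit = trans (hasExp-cong Q (pairsOf π) expo≡′ e) hit
    where
    r = relabel n (flip μ) π∈
    Q = map (both (μ ⟨$⟩ˡ_)) (pairsOf (image r))
    expo≡′ : ∀ i j → expo Q i j ≡ expo (pairsOf π) i j
    expo≡′ i j = begin
      expo Q i j                                      ≡⟨ expo-relabel μ (pairsOf (image r)) i j ⟩
      expo (pairsOf (image r)) (μ ⟨$⟩ʳ i) (μ ⟨$⟩ʳ j)  ≡⟨ expo≡ r _ _ ⟩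
      expo (pairsOf π) (μ ⟨$⟩ˡ (μ ⟨$⟩ʳ i)) (μ ⟨$⟩ˡ (μ ⟨$⟩ʳ j))
        ≡⟨ cong₂ (expo (pairsOf π)) (inverseˡ μ) (inverseˡ μ) ⟩
      expo (pairsOf π) i j                            ∎

  -- The terms of pf have pairwise distinct monomials, so on either side the
  -- coefficient of e is a single sign or 0. Relabelling by μ carries a term of
  -- act μ pf with monomial e to a term of pf with monomial e and the same sign,
  -- and relabelling by μ⁻¹ goes back.
  coeff-act≈coeff : coeff K (map actedTerm (Spf n)) e ≈ coeff K (map term (Spf n)) e
  coeff-act≈coeff with any? (λ π → hasExp (proj₂ (actedTerm π)) e Boolₚ.≟ true) (Spf n)
  ... | no none = ≈-trans (Act.coeff-map-none (Spf n) (λ π∈ hit → none (lose π∈ hit)))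
    (≈-sym (Pf.coeff-map-none (Spf n)
      (λ π∈ hit → none (lose (image∈ (relabel n (flip μ) π∈)) (hasExp-relabel⁻¹ π∈ hit)))))
  ... | yes some with find some
  ... | π , π∈ , hit = ≈-trans (Act.coeff-map-single (Spf-unique n) π∈ hit only)
    (≈-trans (≈-reflexive (sym (relabel-sign n K μ∈D π∈ r)))
             (≈-sym (Pf.coeff-map-single (Spf-unique n) (image∈ r) (hasExp-relabel π∈ hit) only′)))
    where
    r = relabel n μ π∈
    only : ∀ {π′} → π′ ∈ Spf n → Act.HasExp π′ → π′ ≡ π
    only π′∈ hit′ = relabel-injective n π′∈ π∈ (relabel n μ π′∈) r
      (Spf-hasExp-injective n (image∈ (relabel n μ π′∈)) (image∈ r)
                              (hasExp-relabel π′∈ hit′) (hasExp-relabel π∈ hit))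
    only′ : ∀ {π′} → π′ ∈ Spf n → Pf.HasExp π′ → π′ ≡ image r
    only′ π′∈ hit′ = Spf-hasExp-injective n π′∈ (image∈ r) hit′ (hasExp-relabel π∈ hit)

lemma5p1 : ∀ {c ℓ} (K : CommutativeRing c ℓ) → IsField K → CharNot2 K →
           (n : ℕ) → 1 ≤ n → (μ : Permutation (2 * n) (2 * n)) → InD (2 * n) μ →
           PolyEq K (act {K = K} μ (pf K n)) (pf K n)
lemma5p1 K _ _ n _ μ μ∈D e rewrite Invariance.act-pf≡ K n μ μ∈D e =
  Invariance.coeff-act≈coeff K n μ μ∈D e
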